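{- Let $\mathcal{T}$ be a single-path loop as described in the context which is monotonic, and let $x[\vec r] \in \mathcal{L}$ be displacing. Suppose that for each lvalue $\ell \in \mathit{Lval}(\vec r)$ a closed form $\ell^{(n)}$ is given, and let $\vec r^{(n)} := \vec r[\ell/\ell^{(n)} \mid \ell \in \mathit{Lval}(\vec r)]$. Then $x[\vec r]^{(n)} := x[\vec r^{(n)}]$ is a closed form for $x[\vec r]$, i.e., $x[\vec r^{(n)}] = \mathsf{up}^n(x[\vec r])$ holds for all $n \in \mathbb{N}$.
   Context: Variables and arrays: $\mathcal{V}$ is a countably infinite set of variables, each $x \in \mathcal{V}$ having an arity $\mathsf{arity}(x) \in \mathbb{N}$; $x$ denotes a function $\mathbb{Z}^{\mathsf{arity}(x)} \to \mathbb{Z}$ (arity $0$ means scalar; $i[\,]$ is written $i$). Rvalues: $r ::= c \mid r \circ r \mid x[r_1,\ldots,r_k]$ with $c \in \mathbb{Z}$, $\circ$ an arithmetic operator, $k = \mathsf{arity}(x)$. An lvalue is an rvalue of the form $x[\vec r]$. $\mathit{Lval}(r)$ is the set of top-level lvalues of $r$: $\{r\}$ if $r$ is an lvalue, $\mathit{Lval}(r_1)\cup\mathit{Lval}(r_2)$ if $r=r_1\circ r_2$, $\emptyset$ if $r\in\mathbb{Z}$; for vectors take the union. Expressions may also contain if-then-else and $\lambda$-array expressions; states assign functions to variables, and an equation "holds" (is valid) if it is true in every state. Loop $\mathcal{T}$: $\mathbf{while}\ \phi\ \mathbf{do}\ (\ell_1,\ldots,\ell_m)\leftarrow(r_1,\ldots,r_m)$,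 $\phi$ a conjunction of (in)equations over rvalues, $\ell_j = x_j[\vec r_j]$ lvalues with $x_i \neq x_j$ or $\vec r_i \neq \vec r_j$ for $i\neq j$, simultaneous update; $\vec\ell=(\ell_1,\ldots,\ell_m)$, $\mathsf{rhs}(x_j[\vec r_j]) := r_j$. Update: $\mathsf{up}_x(\text{empty}) = x$; $\mathsf{up}_x(x[\vec r],\vec\ell') = \lambda\vec i.\ \mathbf{if}\ \vec i=\vec r\ \mathbf{then}\ \mathsf{rhs}(x[\vec r])\ \mathbf{else}\ \mathsf{up}_x(\vec\ell')[\vec i]$ ($\vec i$ fresh); $\mathsf{up}_x(y[\vec r],\vec\ell') = \mathsf{up}_x(\vec\ell')$ for $y\neq x$. $\mathsf{up}$ is the substitution $[x/\mathsf{up}_x(\vec\ell)\mid x\in\mathcal{V}]$ (applied componentwise to vectors), $\mathsf{up}^n$ its $n$-fold iteration. Order and monotonicity: vectors of equal length are compared lexicographically ($\vec r<\vec r'$ iff some $i$ has $r_i<r'_i$ and $r_j=r'_j$ for $j<i$; two empty vectors are equal). The paper assumes throughout that monotonic loops are increasing: $\mathcal{T}$ is monotonic if for every $x\in\mathcal{V}$ the formula $\bigwedge_{x[\vec r]\in\vec\ell} \vec r \le \mathsf{up}(\vec r)$ is valid. Relevant lvalues: $\mathcal{L}$ is the smallest set with $\mathit{Lval}(r_j)\subseteq\mathcal{L}$ for all $j$ and with $x[\vec r]\in\mathcal{L} \Rightarrow \mathit{Lval}(\vec r)\subseteq\mathcal{L}$. An lvalue $x[\vec r]\in\mathcal{L}$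 is displacing if for all $\vec r'$ with $x[\vec r']\in\vec\ell$, $\vec r' < \mathsf{up}(\vec r)$ is valid. Closed form: for a fresh scalar variable $n$, an expression $\ell^{(n)}$ over $\mathcal{V}\cup\{n\}$ is a closed form for the lvalue $\ell$ if $\ell^{(n)} = \mathsf{up}^n(\ell)$ holds for all $n\in\mathbb{N}$. -}

module Defs where

open import Data.Nat as ℕ using (ℕ; zero; suc)
open import Data.Integer as ℤ using (ℤ; +_)
open import Data.Fin using (Fin; toℕ; _↑ˡ_)
open import Data.Vec using (Vec; []; _∷_; lookup; tabulate; _++_)
open import Data.Vec.Properties using (≡-dec)
open import Data.List using (List; []; _∷_; map) renaming (_++_ to _++ₗ_)
open import Data.List.Membership.Propositional using (_∈_)
open import Data.List.Relation.Unary.AllPairs using (AllPairs)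
open import Data.Product using (Σ; Σ-syntax; ∃; _×_; _,_; proj₁)
open import Data.Sum using (_⊎_)
open import Data.Bool using (if_then_else_)
open import Relation.Nullary using (Dec; yes; no; does)
open import Relation.Binary.PropositionalEquality using (_≡_; _≢_; refl; cong)

record Var : Set where
  constructor mkVar
  field
    name  : ℕ
    arity : ℕ
open Var public

_≟V_ : (x y : Var) → Dec (x ≡ y)
mkVar n a ≟V mkVar m b with n ℕ.≟ m | a ℕ.≟ b
... | yes refl | yes refl = yes refl
... | no p     | _        = no λ { refl → p refl }
... | yes _    | no q     = no λ { refl → q refl }

data Op : Set where
  plus minus times : Op

⟦_⟧op : Op → ℤ → ℤ → ℤ
⟦ plus  ⟧op = ℤ._+_
⟦ minus ⟧op = ℤ._-_
⟦ times ⟧op = ℤ._*_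

data RVal : Set where
  con : ℤ → RVal
  bin : Op → RVal → RVal → RVal
  acc : (x : Var) → Vec RVal (arity x) → RVal

LVal : Set
LVal = Σ[ x ∈ Var ] Vec RVal (arity x)

mutual
  Lval : RVal → List LVal
  Lval (con c)     = []
  Lval (bin o a b) = Lval a ++ₗ Lval b
  Lval (acc x rs)  = (x , rs) ∷ []

  LvalVec : ∀ {k} → Vec RVal k → List LVal
  LvalVec []       = []
  LvalVec (r ∷ rs) = Lval r ++ₗ LvalVec rs

-- Extended expressions over V ∪ {n}: with if-then-else and λ-arrays.
-- Γ = number of (λ-bound) index variables in scope (de Bruijn).

mutual
  data Exp (Γ : ℕ) : Set where
    con  : ℤ → Exp Γ
    bin  : Op → Exp Γ → Exp Γ → Exp Γ
    app  : ∀ {k} → Arr Γ k → Vec (Exp Γ) k → Exp Γ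
    -- if v⃗ = w⃗ then a else b
    ite  : ∀ {k} → Vec (Exp Γ) k → Vec (Exp Γ) k → Exp Γ → Exp Γ → Exp Γ
    bvar : Fin Γ → Exp Γ
    nvar : Exp Γ                      -- the fresh scalar variable n

  data Arr (Γ : ℕ) : ℕ → Set where
    var : (x : Var) → Arr Γ (arity x)
    lam : ∀ {k} → Exp (k ℕ.+ Γ) → Arr Γ k

State : Set
State = (x : Var) → Vec ℤ (arity x) → ℤ

-- Evaluation: state σ, value ν of the variable n, bound index values ρ
mutual
  ev : ∀ {Γ} → Exp Γ → State → ℤ → Vec ℤ Γ → ℤ
  ev (con c)       σ ν ρ = c
  ev (bin o a b)   σ ν ρ = ⟦ o ⟧op (ev a σ ν ρ) (ev b σ ν ρ)
  ev (app a es)    σ ν ρ = evA a σ ν ρ (evs es σ ν ρ)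
  ev (ite v w a b) σ ν ρ =
    if does (≡-dec ℤ._≟_ (evs v σ ν ρ) (evs w σ ν ρ)) then ev a σ ν ρ else ev b σ ν ρ
  ev (bvar i)      σ ν ρ = lookup ρ i
  ev nvar          σ ν ρ = ν

  evA : ∀ {Γ k} → Arr Γ k → State → ℤ → Vec ℤ Γ → Vec ℤ k → ℤ
  evA (var x) σ ν ρ args = σ x args
  evA (lam e) σ ν ρ args = ev e σ ν (args ++ ρ)

  evs : ∀ {Γ k} → Vec (Exp Γ) k → State → ℤ → Vec ℤ Γ → Vec ℤ k
  evs []       σ ν ρ = []
  evs (e ∷ es) σ ν ρ = ev e σ ν ρ ∷ evs es σ ν ρ

mutual
  emb : ∀ {Γ} → RVal → Exp Γ
  emb (con c)     = con c
  emb (bin o a b) = bin o (emb a) (emb b)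
  emb (acc x rs)  = app (var x) (embVec rs)

  embVec : ∀ {Γ k} → Vec RVal k → Vec (Exp Γ) k
  embVec []       = []
  embVec (r ∷ rs) = emb r ∷ embVec rs

lvExp : ∀ {Γ} → LVal → Exp Γ
lvExp (x , rs) = app (var x) (embVec rs)

data Atom : Set where
  _≐_ _≠_ _≤ₐ_ _<ₐ_ : RVal → RVal → Atom

record Upd : Set where
  constructor _≔_
  field
    lhs : LVal
    rhs : RVal
open Upd public

record Loop : Set where
  field
    guard    : List Atom                         -- conjunction
    updates  : List Upd
    distinct : AllPairs _≢_ (map lhs updates)

-- index variables i⃗ (the k innermost bound variables)
idx : ∀ k Γ → Vec (Exp (k ℕ.+ Γ)) k
idx k Γ = tabulate (λ i → bvar (i ↑ˡ Γ))

upArr : (Γ : ℕ) (x : Var) → List Upd → Arr Γ (arity x)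
upArr Γ x [] = var x
upArr Γ x (((y , rs) ≔ r) ∷ us) with y ≟V x
... | yes refl = lam (ite (idx (arity x) Γ) (embVec rs) (emb r)
                          (app (upArr (arity x ℕ.+ Γ) x us) (idx (arity x) Γ)))
... | no _     = upArr Γ x us

module _ (us : List Upd) where
  mutual
    upE : ∀ {Γ} → Exp Γ → Exp Γ
    upE (con c)       = con c
    upE (bin o a b)   = bin o (upE a) (upE b)
    upE (app a es)    = app (upA a) (upVs es)
    upE (ite v w a b) = ite (upVs v) (upVs w) (upE a) (upE b)
    upE (bvar i)      = bvar i
    upE nvar          = nvar

    upA : ∀ {Γ k} → Arr Γ k → Arr Γ k
    upA {Γ} (var x) = upArr Γ x us
    upA (lam e)     = lam (upE e)

    upVs : ∀ {Γ k} → Vec (Exp Γ) k → Vec (Exp Γ) k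
    upVs []       = []
    upVs (e ∷ es) = upE e ∷ upVs es

up : Loop → ∀ {Γ} → Exp Γ → Exp Γ
up T = upE (Loop.updates T)

upVec : Loop → ∀ {Γ k} → Vec (Exp Γ) k → Vec (Exp Γ) k
upVec T = upVs (Loop.updates T)

upⁿ : Loop → ℕ → ∀ {Γ} → Exp Γ → Exp Γ
upⁿ T zero    e = e
upⁿ T (suc n) e = up T (upⁿ T n e)

LexLt : ∀ {k} → Vec ℤ k → Vec ℤ k → Set
LexLt {k} v w = Σ[ i ∈ Fin k ] (lookup v i ℤ.< lookup w i ×
                  (∀ (j : Fin k) → toℕ j ℕ.< toℕ i → lookup v j ≡ lookup w j))

LexLe : ∀ {k} → Vec ℤ k → Vec ℤ k → Set
LexLe v w = LexLt v w ⊎ v ≡ w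

Monotonic : Loop → Set
Monotonic T = ∀ (x : Var) (rs : Vec RVal (arity x)) →
  (x , rs) ∈ map lhs (Loop.updates T) →
  ∀ (σ : State) (ν : ℤ) →
    LexLe (evs (embVec rs) σ ν []) (evs (upVec T (embVec rs)) σ ν [])

data Relevant (T : Loop) : LVal → Set where
  rhsLval : ∀ {u ℓ} → u ∈ Loop.updates T → ℓ ∈ Lval (rhs u) → Relevant T ℓ
  idxLval : ∀ {x rs ℓ} → Relevant T (x , rs) → ℓ ∈ LvalVec rs → Relevant T ℓ

Displacing : Loop → LVal → Set
Displacing T (x , rs) = Relevant T (x , rs) ×
  (∀ (rs′ : Vec RVal (arity x)) → (x , rs′) ∈ map lhs (Loop.updates T) →
    ∀ (σ : State) (ν : ℤ) →
      LexLt (evs (embVec rs′) σ ν []) (evs (upVec T (embVec rs)) σ ν []))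

IsClosedForm : Loop → LVal → Exp 0 → Set
IsClosedForm T ℓ e = ∀ (n : ℕ) (σ : State) →
  ev e σ (+ n) [] ≡ ev (upⁿ T n (lvExp ℓ)) σ (+ n) []

module _ (cf : LVal → Exp 0) where
  mutual
    substCF : RVal → Exp 0
    substCF (con c)     = con c
    substCF (bin o a b) = bin o (substCF a) (substCF b)
    substCF (acc x rs)  = cf (x , rs)

    substCFVec : ∀ {k} → Vec RVal k → Vec (Exp 0) k
    substCFVec []       = []
    substCFVec (r ∷ rs) = substCF r ∷ substCFVec rs

{-# OPTIONS --safe #-}

-- Evaluating up^n e in a state σ is evaluating e in the state σₙ reached after n
-- iterations of the loop body. By the closed forms, r⃗^(n) evaluates in σ to the
-- value v of r⃗ in σₙ, so it remains to show that σₙ and σ agree on x at v, i.e.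
-- that no iteration i < n writes to x[v]. A write position r⃗' of x evaluated in σᵢ
-- is, by monotonicity, at most its value in σₙ₋₁, and since x[r⃗] is displacing that
-- is strictly below the value v of r⃗ in σₙ.
module Submission where

open import Defs
open import Data.Vec using (Vec)
open import Data.Product using (_,_)
open import Data.List.Membership.Propositional using (_∈_)

open import Level using (Level)
open import Data.Nat as ℕ using (ℕ; zero; suc; _≤′_; ≤′-refl; ≤′-step; z<s; s≤s)
open import Data.Nat.Properties as ℕ using (≤⇒≤′)
open import Data.Nat.GeneralisedArithmetic using (iterate; iterate-is-fold)
open import Data.Integer as ℤ using (ℤ; +_)
open import Data.Integer.Properties as ℤ using ()
open import Data.Fin as Fin using (Fin; toℕ; _↑ˡ_)
open import Data.Fin.Properties using (toℕ-injective)
open import Data.Vec using ([]; _∷_; lookup; tabulate; _++_)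
open import Data.Vec.Properties using (≡-dec; lookup-++ˡ; tabulate-cong; tabulate∘lookup)
open import Data.List using (List; []; _∷_; map)
open import Data.List.Relation.Unary.Any using (here; there)
open import Data.List.Membership.Propositional.Properties using (∈-++⁺ˡ; ∈-++⁺ʳ)
open import Data.Sum using (inj₁; inj₂)
open import Data.Bool using (if_then_else_)
open import Function using (_∘_)
open import Relation.Nullary using (yes; no; does)
open import Relation.Nullary.Decidable using (dec-false)
open import Relation.Binary using (Rel; Reflexive; Transitive; tri<; tri≈; tri>)
open import Relation.Binary.PropositionalEquality
open ≡-Reasoning

private
  variable
    a r : Level
    A : Set a
    Γ k : ℕ

mutual
  evR : RVal → State → ℤ
  evR (con c)     σ = c
  evR (bin o a b) σ = ⟦ o ⟧op (evR a σ) (evR b σ)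
  evR (acc x rs)  σ = σ x (evRs rs σ)

  evRs : Vec RVal k → State → Vec ℤ k
  evRs []       σ = []
  evRs (r ∷ rs) σ = evR r σ ∷ evRs rs σ

mutual
  ev-emb : (r : RVal) (σ : State) (ν : ℤ) (ρ : Vec ℤ Γ) → ev (emb r) σ ν ρ ≡ evR r σ
  ev-emb (con c)     σ ν ρ = refl
  ev-emb (bin o a b) σ ν ρ = cong₂ ⟦ o ⟧op (ev-emb a σ ν ρ) (ev-emb b σ ν ρ)
  ev-emb (acc x rs)  σ ν ρ = cong (σ x) (evs-embVec rs σ ν ρ)

  evs-embVec : (rs : Vec RVal k) (σ : State) (ν : ℤ) (ρ : Vec ℤ Γ) →
               evs (embVec rs) σ ν ρ ≡ evRs rs σ
  evs-embVec []       σ ν ρ = refl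
  evs-embVec (r ∷ rs) σ ν ρ = cong₂ _∷_ (ev-emb r σ ν ρ) (evs-embVec rs σ ν ρ)

ev-lvExp : (x : Var) (rs : Vec RVal (arity x)) (σ : State) (ν : ℤ) (ρ : Vec ℤ Γ) →
           ev (lvExp (x , rs)) σ ν ρ ≡ σ x (evRs rs σ)
ev-lvExp x rs σ ν ρ = cong (σ x) (evs-embVec rs σ ν ρ)

evs-tabulate : (f : Fin k → Exp Γ) (σ : State) (ν : ℤ) (ρ : Vec ℤ Γ) →
               evs (tabulate f) σ ν ρ ≡ tabulate (λ i → ev (f i) σ ν ρ)
evs-tabulate {zero}  f σ ν ρ = refl
evs-tabulate {suc k} f σ ν ρ =
  cong (ev (f Fin.zero) σ ν ρ ∷_) (evs-tabulate (f ∘ Fin.suc) σ ν ρ)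

evs-idx : (σ : State) (ν : ℤ) (v : Vec ℤ k) (ρ : Vec ℤ Γ) → evs (idx k Γ) σ ν (v ++ ρ) ≡ v
evs-idx {k} {Γ} σ ν v ρ = begin
  evs (idx k Γ) σ ν (v ++ ρ)                 ≡⟨ evs-tabulate _ σ ν (v ++ ρ) ⟩
  tabulate (λ i → lookup (v ++ ρ) (i ↑ˡ Γ))  ≡⟨ tabulate-cong (lookup-++ˡ v ρ) ⟩
  tabulate (lookup v)                        ≡⟨ tabulate∘lookup v ⟩
  v                                          ∎

-- One iteration of the loop body; as in up_x, the first update of x[v] in the list wins.
step : List Upd → State → State
step []                    σ x v = σ x v
step (((y , rs) ≔ r) ∷ us) σ x v with y ≟V x
... | yes refl = if does (≡-dec ℤ._≟_ v (evRs rs σ)) then evR r σ else step us σ x v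
... | no _     = step us σ x v

evA-upArr : (x : Var) (us : List Upd) (σ : State) (ν : ℤ) (ρ : Vec ℤ Γ) (v : Vec ℤ (arity x)) →
            evA (upArr Γ x us) σ ν ρ v ≡ step us σ x v
evA-upArr x []                    σ ν ρ v = refl
evA-upArr x (((y , rs) ≔ r) ∷ us) σ ν ρ v with y ≟V x
... | no _ = evA-upArr x us σ ν ρ v
... | yes refl
  rewrite evs-idx σ ν v ρ
        | evs-embVec rs σ ν (v ++ ρ)
        | ev-emb r σ ν (v ++ ρ)
        | evA-upArr x us σ ν (v ++ ρ) v = refl

module _ (us : List Upd) where
  mutual
    ev-upE : (e : Exp Γ) (σ : State) (ν : ℤ) (ρ : Vec ℤ Γ) →
             ev (upE us e) σ ν ρ ≡ ev e (step us σ) ν ρ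
    ev-upE (con c)       σ ν ρ = refl
    ev-upE (bin o a b)   σ ν ρ = cong₂ ⟦ o ⟧op (ev-upE a σ ν ρ) (ev-upE b σ ν ρ)
    ev-upE (app a es)    σ ν ρ rewrite evs-upVs es σ ν ρ = evA-upA a σ ν ρ _
    ev-upE (ite v w a b) σ ν ρ
      rewrite evs-upVs v σ ν ρ | evs-upVs w σ ν ρ | ev-upE a σ ν ρ | ev-upE b σ ν ρ = refl
    ev-upE (bvar i)      σ ν ρ = refl
    ev-upE nvar          σ ν ρ = refl

    evA-upA : (a : Arr Γ k) (σ : State) (ν : ℤ) (ρ : Vec ℤ Γ) (v : Vec ℤ k) →
              evA (upA us a) σ ν ρ v ≡ evA a (step us σ) ν ρ v
    evA-upA (var x) σ ν ρ v = evA-upArr x us σ ν ρ v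
    evA-upA (lam e) σ ν ρ v = ev-upE e σ ν (v ++ ρ)

    evs-upVs : (es : Vec (Exp Γ) k) (σ : State) (ν : ℤ) (ρ : Vec ℤ Γ) →
               evs (upVs us es) σ ν ρ ≡ evs es (step us σ) ν ρ
    evs-upVs []       σ ν ρ = refl
    evs-upVs (e ∷ es) σ ν ρ = cong₂ _∷_ (ev-upE e σ ν ρ) (evs-upVs es σ ν ρ)

iterate-suc : (f : A → A) (z : A) (n : ℕ) → iterate f z (suc n) ≡ f (iterate f z n)
iterate-suc f z n = trans (sym (iterate-is-fold z f (suc n))) (cong f (iterate-is-fold z f n))

suc-mono⇒mono : {_≼_ : Rel A r} → Reflexive _≼_ → Transitive _≼_ →
                (f : ℕ → A) → (∀ i → f i ≼ f (suc i)) → ∀ {i j} → i ≤′ j → f i ≼ f j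
suc-mono⇒mono                refl′ trans′ f f-suc {i} ≤′-refl           = refl′ {f i}
suc-mono⇒mono {_≼_ = _≼_} refl′ trans′ f f-suc {i} (≤′-step {j} i≤j) =
  trans′ {f i} {f j} {f (suc j)}
    (suc-mono⇒mono {_≼_ = _≼_} refl′ trans′ f f-suc i≤j) (f-suc j)

LexLt-trans : {u v w : Vec ℤ k} → LexLt u v → LexLt v w → LexLt u w
LexLt-trans (i , uᵢ<vᵢ , u=v) (j , vⱼ<wⱼ , v=w) with ℕ.<-cmp (toℕ i) (toℕ j)
... | tri< i<j _ _ =
  i , ℤ.<-≤-trans uᵢ<vᵢ (ℤ.≤-reflexive (v=w i i<j)) ,
  λ l l<i → trans (u=v l l<i) (v=w l (ℕ.<-trans l<i i<j))
... | tri> _ _ j<i =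
  j , ℤ.≤-<-trans (ℤ.≤-reflexive (u=v j j<i)) vⱼ<wⱼ ,
  λ l l<j → trans (u=v l (ℕ.<-trans l<j j<i)) (v=w l l<j)
... | tri≈ _ i≡j _ with refl ← toℕ-injective i≡j =
  i , ℤ.<-trans uᵢ<vᵢ vⱼ<wⱼ , λ l l<i → trans (u=v l l<i) (v=w l l<i)

LexLe-trans : {u v w : Vec ℤ k} → LexLe u v → LexLe v w → LexLe u w
LexLe-trans {u = u} {v} {w} (inj₁ u<v) (inj₁ v<w) = inj₁ (LexLt-trans {u = u} {v} {w} u<v v<w)
LexLe-trans u≤v        (inj₂ refl) = u≤v
LexLe-trans (inj₂ refl) v≤w        = v≤w

LexLe-LexLt-trans : {u v w : Vec ℤ k} → LexLe u v → LexLt v w → LexLt u w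
LexLe-LexLt-trans {u = u} {v} {w} (inj₁ u<v) v<w = LexLt-trans {u = u} {v} {w} u<v v<w
LexLe-LexLt-trans (inj₂ refl) v<w = v<w

LexLt⇒≢ : {v w : Vec ℤ k} → LexLt v w → v ≢ w
LexLt⇒≢ (i , vᵢ<wᵢ , _) refl = ℤ.<-irrefl refl vᵢ<wᵢ

step-unwritten : (us : List Upd) (σ : State) (x : Var) (v : Vec ℤ (arity x)) →
                 (∀ rs → (x , rs) ∈ map lhs us → v ≢ evRs rs σ) → step us σ x v ≡ σ x v
step-unwritten []                    σ x v unwritten = refl
step-unwritten (((y , rs) ≔ r) ∷ us) σ x v unwritten with y ≟V x
... | no _ = step-unwritten us σ x v (λ rs′ → unwritten rs′ ∘ there)
... | yes refl rewrite dec-false (≡-dec ℤ._≟_ v (evRs rs σ)) (unwritten rs (here refl)) =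
  step-unwritten us σ x v (λ rs′ → unwritten rs′ ∘ there)

iterate-unwritten : (us : List Upd) (n : ℕ) (σ : State) (x : Var) (v : Vec ℤ (arity x)) →
  (∀ i → i ℕ.< n → ∀ rs → (x , rs) ∈ map lhs us → v ≢ evRs rs (iterate (step us) σ i)) →
  iterate (step us) σ n x v ≡ σ x v
iterate-unwritten us zero    σ x v unwritten = refl
iterate-unwritten us (suc n) σ x v unwritten = begin
  iterate (step us) (step us σ) n x v ≡⟨ iterate-unwritten us n (step us σ) x v
                                           (λ i → unwritten (suc i) ∘ s≤s) ⟩
  step us σ x v                       ≡⟨ step-unwritten us σ x v (unwritten 0 z<s) ⟩
  σ x v                               ∎

module Iterations (T : Loop) where

  private
    us : List Upd
    us = Loop.updates T

  _after_ : State → ℕ → State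
  σ after n = iterate (step us) σ n

  ev-upⁿ : (n : ℕ) (e : Exp Γ) (σ : State) (ν : ℤ) (ρ : Vec ℤ Γ) →
           ev (upⁿ T n e) σ ν ρ ≡ ev e (σ after n) ν ρ
  ev-upⁿ zero    e σ ν ρ = refl
  ev-upⁿ (suc n) e σ ν ρ = trans (ev-upE us (upⁿ T n e) σ ν ρ) (ev-upⁿ n e (step us σ) ν ρ)

  ev-upⁿ-lvExp : (n : ℕ) (x : Var) (rs : Vec RVal (arity x)) (σ : State) (ν : ℤ) →
                 ev (upⁿ T n (lvExp (x , rs))) σ ν [] ≡ (σ after n) x (evRs rs (σ after n))
  ev-upⁿ-lvExp n x rs σ ν =
    trans (ev-upⁿ n (lvExp (x , rs)) σ ν []) (ev-lvExp x rs (σ after n) ν [])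

  evs-upVec-embVec : (rs : Vec RVal k) (σ : State) (ν : ℤ) →
                     evs (upVec T (embVec rs)) σ ν [] ≡ evRs rs (step us σ)
  evs-upVec-embVec rs σ ν = trans (evs-upVs us (embVec rs) σ ν []) (evs-embVec rs (step us σ) ν [])

  -- Monotonic and Displacing quantify over the value ν of n, which rvalues never mention.
  module _ {x : Var} {rs′ : Vec RVal (arity x)} (writes : (x , rs′) ∈ map lhs us) where

    step-monotonic : Monotonic T → (σ : State) → LexLe (evRs rs′ σ) (evRs rs′ (step us σ))
    step-monotonic mono σ =
      subst₂ LexLe (evs-embVec rs′ σ (+ 0) []) (evs-upVec-embVec rs′ σ (+ 0))
                   (mono x rs′ writes σ (+ 0))

    step-displacing : {rs : Vec RVal (arity x)} → Displacing T (x , rs) →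
                      (σ : State) → LexLt (evRs rs′ σ) (evRs rs (step us σ))
    step-displacing {rs} (_ , disp) σ =
      subst₂ LexLt (evs-embVec rs′ σ (+ 0) []) (evs-upVec-embVec rs σ (+ 0))
                   (disp rs′ writes σ (+ 0))

    displacing-above-writes : Monotonic T → {rs : Vec RVal (arity x)} → Displacing T (x , rs) →
      (σ : State) {i n : ℕ} → i ℕ.< n → LexLt (evRs rs′ (σ after i)) (evRs rs (σ after n))
    displacing-above-writes mono {rs} displacing σ {i} {suc m} (s≤s i≤m) =
      LexLe-LexLt-trans {w = evRs rs (σ after suc m)} writes-mono-up-to-m last-step-displacing
      where
      writes-mono-step : ∀ j → LexLe (evRs rs′ (σ after j)) (evRs rs′ (σ after suc j))
      writes-mono-step j = subst (λ τ → LexLe (evRs rs′ (σ after j)) (evRs rs′ τ))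
                                 (sym (iterate-suc (step us) σ j))
                                 (step-monotonic mono (σ after j))

      writes-mono-up-to-m : LexLe (evRs rs′ (σ after i)) (evRs rs′ (σ after m))
      writes-mono-up-to-m = suc-mono⇒mono {_≼_ = LexLe} (inj₂ refl) LexLe-trans
                              (λ j → evRs rs′ (σ after j)) writes-mono-step (≤⇒≤′ i≤m)

      last-step-displacing : LexLt (evRs rs′ (σ after m)) (evRs rs (σ after suc m))
      last-step-displacing = subst (λ τ → LexLt (evRs rs′ (σ after m)) (evRs rs τ))
                                   (sym (iterate-suc (step us) σ m))
                                   (step-displacing displacing (σ after m))

  module _ (cf : LVal → Exp 0) (n : ℕ) (σ : State) where
    mutual
      ev-substCF : (r : RVal) → (∀ ℓ → ℓ ∈ Lval r → IsClosedForm T ℓ (cf ℓ)) →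
                   ev (substCF cf r) σ (+ n) [] ≡ evR r (σ after n)
      ev-substCF (con c)     closed = refl
      ev-substCF (bin o a b) closed = cong₂ ⟦ o ⟧op
        (ev-substCF a (λ ℓ → closed ℓ ∘ ∈-++⁺ˡ))
        (ev-substCF b (λ ℓ → closed ℓ ∘ ∈-++⁺ʳ (Lval a)))
      ev-substCF (acc y ss)  closed =
        trans (closed (y , ss) (here refl) n σ) (ev-upⁿ-lvExp n y ss σ (+ n))

      evs-substCFVec : (rs : Vec RVal k) → (∀ ℓ → ℓ ∈ LvalVec rs → IsClosedForm T ℓ (cf ℓ)) →
                       evs (substCFVec cf rs) σ (+ n) [] ≡ evRs rs (σ after n)
      evs-substCFVec []       closed = refl
      evs-substCFVec (r ∷ rs) closed = cong₂ _∷_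
        (ev-substCF r (λ ℓ → closed ℓ ∘ ∈-++⁺ˡ))
        (evs-substCFVec rs (λ ℓ → closed ℓ ∘ ∈-++⁺ʳ (Lval r)))

theorem1 : (T : Loop) → Monotonic T →
    (x : Var) (rs : Vec RVal (arity x)) → Displacing T (x , rs) →
    (cf : LVal → Exp 0) →
    (∀ ℓ → ℓ ∈ LvalVec rs → IsClosedForm T ℓ (cf ℓ)) →
    IsClosedForm T (x , rs) (app (var x) (substCFVec cf rs))
theorem1 T mono x rs displacing cf closed n σ = begin
  σ x (evs (substCFVec cf rs) σ (+ n) [])  ≡⟨ cong (σ x) (evs-substCFVec cf n σ rs closed) ⟩
  σ x v                                    ≡⟨ sym (iterate-unwritten (Loop.updates T) n σ x v unwritten) ⟩
  σₙ x v                                   ≡⟨ sym (ev-upⁿ-lvExp n x rs σ (+ n)) ⟩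
  ev (upⁿ T n (lvExp (x , rs))) σ (+ n) [] ∎
  where
  open Iterations T
  σₙ : State
  σₙ = σ after n

  v : Vec ℤ (arity x)
  v = evRs rs σₙ

  unwritten : ∀ i → i ℕ.< n → ∀ rs′ → (x , rs′) ∈ map lhs (Loop.updates T) →
              v ≢ evRs rs′ (σ after i)
  unwritten i i<n rs′ writes =
    LexLt⇒≢ (displacing-above-writes writes mono displacing σ i<n) ∘ sym
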